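{- Let $U$ be the permutation of $C(n)$ defined as follows: given $c \in C(n)$, append a final part $0$ if $c$ has odd length, so $c=(c_1,\ldots,c_{2u})$; replace each pair $(c_{2i-1},c_{2i})$ by $(1^{c_{2i-1}-c_{2i}-1},2c_{2i}+1)$ if $c_{2i}-c_{2i-1}<0$, and by $(1^{c_{2i-1}+c_{2i}-2k},2k)$ if $2k-2\le c_{2i}-c_{2i-1}<2k$ for an integer $k\ge 1$; and concatenate. Then the set $C^U(n)$ of compositions $c\in C(n)$ with $U(c)=c$ consists exactly of the compositions $c=(c_1,\ldots,c_t)\in C(n)$ such that $c_{2i-1}=1$ for every $i$ with $2i-1\le t$ and $c_{2i}$ is even for every $i$ with $2i \le t$. Moreover, $c^U(n)=|C^U(n)|$ satisfies $c^U(n)=c^U(n-2)+c^U(n-3)$ for $n\ge 4$, with $c^U(1)=1$, $c^U(2)=0$, $c^U(3)=1$.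
   Context: $C(n)$ is the set of compositions of a positive integer $n$ (finite sequences of positive integers summing to $n$). $1^m$ denotes $m$ consecutive parts equal to $1$ (nothing if $m=0$); a resulting pair $(1^{m-1},1)$ with $c_{2i}=0$ is just $m$ ones. -}

module Defs where

open import Data.Nat using (ℕ; zero; suc; _+_; _*_; _∸_; _≤_; _<?_)
open import Data.Nat.DivMod using (_/_)
open import Data.Nat.Divisibility using (_∣_)
open import Data.List using (List; []; _∷_; _++_; replicate; [_])
open import Data.Nat.ListAction using (sum)
open import Data.List.Relation.Unary.All using (All)
open import Data.Product using (Σ; _×_)
open import Data.Unit using (⊤)
open import Relation.Binary.PropositionalEquality using (_≡_)
open import Relation.Nullary using (yes; no)

IsComposition : ℕ → List ℕ → Set
IsComposition n c = All (λ x → 1 ≤ x) c × sum c ≡ n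

C : ℕ → Set
C n = Σ (List ℕ) (IsComposition n)

-- The image of a pair (a , b) = (c_{2i-1}, c_{2i}) under U.
--  * if b - a < 0 (i.e. b < a):  (1^(a-b-1), 2b+1)
--  * otherwise, with k ≥ 1 the unique integer with 2k-2 ≤ b-a < 2k,
--    i.e. k = ⌊(b-a)/2⌋ + 1 :  (1^(a+b-2k), 2k)
Upair : ℕ → ℕ → List ℕ
Upair a b with b <? a
... | yes _ = replicate (a ∸ b ∸ 1) 1 ++ [ 2 * b + 1 ]
... | no  _ = replicate (a + b ∸ 2 * k) 1 ++ [ 2 * k ]
  where
  k : ℕ
  k = suc ((b ∸ a) / 2)

U : List ℕ → List ℕ
U []            = []
U (a ∷ [])      = Upair a 0
U (a ∷ b ∷ cs)  = Upair a b ++ U cs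

OddOnesEvenEven : List ℕ → Set
OddOnesEvenEven []           = ⊤
OddOnesEvenEven (a ∷ [])     = a ≡ 1
OddOnesEvenEven (a ∷ b ∷ cs) = a ≡ 1 × 2 ∣ b × OddOnesEvenEven cs

CU : ℕ → Set
CU n = Σ (List ℕ) (λ c → IsComposition n c × U c ≡ c)

-- A block U(a, b) is a run of ones followed by a single part x carrying the same total a + b,
-- and x is even only when a ≤ b (otherwise x = 2b + 1). So U fixes the pair (a, b) exactly when
-- the run has length one, i.e. a = 1 and b = x is even: the fixed points are the compositions
-- (1, 2k₁, 1, 2k₂, …), possibly ending in a single 1. Such a composition of n ≥ 4 starts with
-- (1, 2 + b); deleting that pair when b = 0 and lowering 2 + b to b otherwise is a bijection onto
-- the fixed compositions of n − 3 and of n − 2.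
{-# OPTIONS --safe #-}
module Submission where

open import Defs
open import Data.Nat using (ℕ; suc; zero; _+_; _*_; _∸_; _≤_; _<?_; s≤s; z≤n; >-nonZero)
open import Data.Nat.Properties
open import Data.Nat.DivMod using (_/_; m/n*n≤m; m*n/n≡m; +-distrib-/-∣ʳ)
open import Data.Nat.Divisibility
  using (_∣_; divides; divides-refl; ∣-refl; ∣⇒≤; ∣m∣n⇒∣m+n; ∣m+n∣m⇒∣n)
open import Data.Nat.Tactic.RingSolver using (solve-∀)
open import Data.List using (List; []; _∷_; _++_; replicate; [_])
open import Data.List.Properties using (≡-dec)
open import Data.List.Relation.Unary.All as All using (All; []; _∷_)
open import Data.Fin using (Fin; zero)
open import Data.Fin.Properties using (+↔⊎)
open import Data.Product using (Σ; _×_; _,_; ∃₂; proj₁; proj₂)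
open import Data.Sum using (_⊎_; inj₁; inj₂)
open import Data.Sum.Function.Propositional using (_⊎-↔_)
open import Data.Unit using (tt)
open import Function.Bundles using (_⇔_; _↔_; mk⇔; mk↔ₛ′)
open import Function.Properties.Inverse using (↔-trans; ↔-sym)
open import Relation.Nullary using (¬_; yes; no; contradiction)
open import Relation.Binary.PropositionalEquality
  using (_≡_; refl; cong; cong₂; subst; trans; sym; module ≡-Reasoning)
import Axiom.UniquenessOfIdentityProofs as UIP

-- The hypothesis 1 ≤ a matters: for a = 0 the run length a + b ∸ 2k truncates at 0.
Upair-shape : ∀ {a} b → 1 ≤ a →
  ∃₂ λ m x → Upair a b ≡ replicate m 1 ++ [ x ]
           × m + x ≡ a + b × 1 ≤ x × (a ≤ b → 2 ∣ x)
Upair-shape {a} b 1≤a with b <? a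
... | yes b<a with (d , refl) ← m≤n⇒∃[o]m+o≡n b<a =
  d , 2 * b + 1 , cong (λ m → replicate m 1 ++ [ 2 * b + 1 ]) ones
    , weight b d , m≤n+m 1 (2 * b) , λ a≤b → contradiction a≤b (<⇒≱ b<a)
  where
  weight : ∀ x y → y + (2 * x + 1) ≡ suc (x + y) + x
  weight = solve-∀
  ones : suc (b + d) ∸ b ∸ 1 ≡ d
  ones = trans (cong (_∸ 1) (+-∸-assoc 1 (m≤m+n b d))) (m+n∸m≡n b d)
... | no b≮a with (d , refl) ← m≤n⇒∃[o]m+o≡n (≮⇒≥ b≮a) =
  a + (a + d) ∸ 2 * k , 2 * k , refl , m∸n+n≡m 2k≤a+b , s≤s z≤n , λ _ → divides k (*-comm 2 k)
  where
  k : ℕ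
  k = suc ((a + d ∸ a) / 2)
  2k≤a+b : 2 * k ≤ a + (a + d)
  2k≤a+b = begin
    2 * k                   ≡⟨ *-comm 2 k ⟩
    2 + (a + d ∸ a) / 2 * 2 ≤⟨ +-monoʳ-≤ 2 (m/n*n≤m (a + d ∸ a) 2) ⟩
    2 + (a + d ∸ a)         ≡⟨ cong (2 +_) (m+n∸m≡n a d) ⟩
    2 + d                   ≤⟨ +-monoˡ-≤ d (+-mono-≤ 1≤a 1≤a) ⟩
    a + a + d               ≡⟨ +-assoc a a d ⟩
    a + (a + d)             ∎
    where open ≤-Reasoning

ones++[x]-match : ∀ m {x a b r s} → m + x ≡ a + b → 1 ≤ x → 1 ≤ b →
  (replicate m 1 ++ [ x ]) ++ r ≡ a ∷ b ∷ s → a ≡ 1 × x ≡ b × r ≡ s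
ones++[x]-match zero {a = a} total _ 1≤b refl = contradiction total (<⇒≢ (m<m+n a 1≤b))
ones++[x]-match (suc zero) _ _ _ refl = refl , refl , refl
ones++[x]-match (suc (suc m)) total 1≤x _ refl =
  contradiction (m+n≡0⇒n≡0 m (suc-injective (suc-injective total))) (m<n⇒n≢0 1≤x)

[1+n*2]/2≡n : ∀ n → suc (n * 2) / 2 ≡ n
[1+n*2]/2≡n n = trans (+-distrib-/-∣ʳ 1 {d = 2} (divides-refl n)) (m*n/n≡m n 2)

Upair-1-even : ∀ q → Upair 1 (suc q * 2) ≡ 1 ∷ suc q * 2 ∷ []
Upair-1-even q = begin
  Upair 1 b                                ≡⟨⟩
  replicate (1 + b ∸ 2 * k) 1 ++ [ 2 * k ] ≡⟨ cong (λ x → replicate (1 + b ∸ x) 1 ++ [ x ]) 2k≡b ⟩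
  replicate (1 + b ∸ b) 1 ++ [ b ]         ≡⟨ cong (λ m → replicate m 1 ++ [ b ]) (m+n∸n≡m 1 b) ⟩
  1 ∷ b ∷ []                               ∎
  where
  open ≡-Reasoning
  b k : ℕ
  b = suc q * 2
  k = suc ((b ∸ 1) / 2)
  2k≡b : 2 * k ≡ b
  2k≡b = trans (cong (λ h → 2 * suc h) ([1+n*2]/2≡n q)) (*-comm 2 (suc q))

U-fixed⇒ : ∀ {c} → All (1 ≤_) c → U c ≡ c → OddOnesEvenEven c
U-fixed⇒ {[]} _ _ = tt
U-fixed⇒ {suc zero ∷ []} _ _ = refl
U-fixed⇒ {suc (suc _) ∷ []} _ ()
U-fixed⇒ {a ∷ b ∷ cs} (1≤a ∷ 1≤b ∷ pos) fixed with Upair-shape b 1≤a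
... | m , x , shape , total , 1≤x , even
  with refl , refl , rest ← ones++[x]-match m total 1≤x 1≤b (trans (cong (_++ U cs) (sym shape)) fixed)
  = refl , even 1≤b , U-fixed⇒ pos rest

U-fixed⇐ : ∀ {c} → All (1 ≤_) c → OddOnesEvenEven c → U c ≡ c
U-fixed⇐ {[]} _ _ = refl
U-fixed⇐ {a ∷ []} _ refl = refl
U-fixed⇐ {a ∷ b ∷ cs} (_ ∷ () ∷ _) (refl , divides zero refl , _)
U-fixed⇐ {a ∷ b ∷ cs} (_ ∷ _ ∷ pos) (refl , divides (suc q) refl , odd-even) =
  cong₂ _++_ (Upair-1-even q) (U-fixed⇐ pos odd-even)

Fixed : ℕ → List ℕ → Set
Fixed n c = IsComposition n c × U c ≡ c

Fixed-irrelevant : ∀ {n c} (p q : Fixed n c) → p ≡ q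
Fixed-irrelevant ((pos , total) , fixed) ((pos′ , total′) , fixed′) =
  cong₂ _,_ (cong₂ _,_ (All.irrelevant ≤-irrelevant pos pos′) (≡-irrelevant total total′))
            (UIP.Decidable⇒UIP.≡-irrelevant (≡-dec _≟_) fixed fixed′)

CU-≡ : ∀ {n c c′} {p : Fixed n c} {q : Fixed n c′} → c ≡ c′ → _≡_ {A = CU n} (c , p) (c′ , q)
CU-≡ {p = p} {q} refl = cong (_ ,_) (Fixed-irrelevant p q)

Fixed⇒OddOnesEvenEven : ∀ {n c} → Fixed n c → OddOnesEvenEven c
Fixed⇒OddOnesEvenEven ((pos , _) , fixed) = U-fixed⇒ pos fixed

OddOnesEvenEven⇒Fixed : ∀ {n c} → IsComposition n c → OddOnesEvenEven c → Fixed n c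
OddOnesEvenEven⇒Fixed comp odd-even = comp , U-fixed⇐ (proj₁ comp) odd-even

Fixed-[a]⇒n≡1 : ∀ {n a} → Fixed n [ a ] → n ≡ 1
Fixed-[a]⇒n≡1 p@((_ , total) , _) with refl ← Fixed⇒OddOnesEvenEven p = sym total

Fixed⇒head≡1 : ∀ {n a b cs} → Fixed n (a ∷ b ∷ cs) → a ≡ 1
Fixed⇒head≡1 p = proj₁ (Fixed⇒OddOnesEvenEven p)

Fixed⇒2∣second : ∀ {n a b cs} → Fixed n (a ∷ b ∷ cs) → 2 ∣ b
Fixed⇒2∣second p = proj₁ (proj₂ (Fixed⇒OddOnesEvenEven p))

Fixed-1∷2∷ : ∀ {n cs} → Fixed n cs → Fixed (3 + n) (1 ∷ 2 ∷ cs)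
Fixed-1∷2∷ ((pos , total) , fixed) =
  (s≤s z≤n ∷ s≤s z≤n ∷ pos , cong (3 +_) total) , cong (λ r → 1 ∷ 2 ∷ r) fixed

Fixed-1∷2∷⁻ : ∀ {n a cs} → Fixed (3 + n) (a ∷ 2 ∷ cs) → Fixed n cs
Fixed-1∷2∷⁻ p@((_ ∷ _ ∷ pos , total) , _) with refl , _ , odd-even ← Fixed⇒OddOnesEvenEven p =
  OddOnesEvenEven⇒Fixed (pos , cong (_∸ 3) total) odd-even

Fixed-grow : ∀ {n a b cs} → Fixed n (a ∷ b ∷ cs) → Fixed (2 + n) (a ∷ 2 + b ∷ cs)
Fixed-grow p@((1≤a ∷ _ ∷ pos , total) , _) with refl , 2∣b , odd-even ← Fixed⇒OddOnesEvenEven p =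
  OddOnesEvenEven⇒Fixed (1≤a ∷ s≤s z≤n ∷ pos , cong (2 +_) total)
    (refl , ∣m∣n⇒∣m+n (∣-refl {2}) 2∣b , odd-even)

Fixed-shrink : ∀ {n a b cs} → Fixed (2 + n) (a ∷ 2 + suc b ∷ cs) → Fixed n (a ∷ suc b ∷ cs)
Fixed-shrink p@((1≤a ∷ _ ∷ pos , total) , _) with refl , 2∣2+b , odd-even ← Fixed⇒OddOnesEvenEven p =
  OddOnesEvenEven⇒Fixed (1≤a ∷ s≤s z≤n ∷ pos , cong (_∸ 2) total)
    (refl , ∣m+n∣m⇒∣n 2∣2+b (∣-refl {2}) , odd-even)

Fixed-0⇒[] : ∀ {c} → Fixed 0 c → c ≡ []
Fixed-0⇒[] {[]} _ = refl
Fixed-0⇒[] {zero ∷ _} ((() ∷ _ , _) , _)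

Fixed-∷∷⇒3≤ : ∀ {n a b cs} → Fixed n (a ∷ b ∷ cs) → 3 ≤ n
Fixed-∷∷⇒3≤ p@((_ ∷ 1≤b ∷ _ , total) , _) with refl , 2∣b , _ ← Fixed⇒OddOnesEvenEven p =
  subst (3 ≤_) total (s≤s (≤-trans (∣⇒≤ {{>-nonZero 1≤b}} 2∣b) (m≤m+n _ _)))

2∤1 : ¬ 2 ∣ 1
2∤1 (divides (suc q) ())

CU-recurrence : ∀ m → CU (4 + m) ↔ (CU (2 + m) ⊎ CU (1 + m))
CU-recurrence m = mk↔ₛ′ to from to∘from from∘to
  where
  to : CU (4 + m) → CU (2 + m) ⊎ CU (1 + m)
  to ([] , (_ , ()) , _)
  to (a ∷ [] , p) = contradiction (Fixed-[a]⇒n≡1 p) λ ()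
  to (a ∷ 0 ∷ cs , ((_ ∷ () ∷ _ , _) , _))
  to (a ∷ 1 ∷ cs , p) = contradiction (Fixed⇒2∣second p) 2∤1
  to (a ∷ 2 ∷ cs , p) = inj₂ (cs , Fixed-1∷2∷⁻ p)
  to (a ∷ suc (suc (suc b)) ∷ cs , p) = inj₁ (a ∷ suc b ∷ cs , Fixed-shrink p)

  from : CU (2 + m) ⊎ CU (1 + m) → CU (4 + m)
  from (inj₁ ([] , (_ , ()) , _))
  from (inj₁ (a ∷ [] , p)) = contradiction (Fixed-[a]⇒n≡1 p) λ ()
  from (inj₁ (a ∷ b ∷ cs , p)) = a ∷ 2 + b ∷ cs , Fixed-grow p
  from (inj₂ (cs , p)) = 1 ∷ 2 ∷ cs , Fixed-1∷2∷ p

  to∘from : ∀ y → to (from y) ≡ y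
  to∘from (inj₁ ([] , (_ , ()) , _))
  to∘from (inj₁ (a ∷ [] , p)) = contradiction (Fixed-[a]⇒n≡1 p) λ ()
  to∘from (inj₁ (a ∷ 0 ∷ cs , ((_ ∷ () ∷ _ , _) , _)))
  to∘from (inj₁ (a ∷ suc b ∷ cs , p)) = cong inj₁ (CU-≡ refl)
  to∘from (inj₂ (cs , p)) = cong inj₂ (CU-≡ refl)

  from∘to : ∀ x → from (to x) ≡ x
  from∘to ([] , (_ , ()) , _)
  from∘to (a ∷ [] , p) = contradiction (Fixed-[a]⇒n≡1 p) λ ()
  from∘to (a ∷ 0 ∷ cs , ((_ ∷ () ∷ _ , _) , _))
  from∘to (a ∷ 1 ∷ cs , p) = contradiction (Fixed⇒2∣second p) 2∤1
  from∘to (a ∷ 2 ∷ cs , p) = CU-≡ (cong (λ h → h ∷ 2 ∷ cs) (sym (Fixed⇒head≡1 p)))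
  from∘to (a ∷ suc (suc (suc b)) ∷ cs , p) = CU-≡ refl

↔Fin1 : ∀ {A : Set} (x : A) → (∀ y → y ≡ x) → A ↔ Fin 1
↔Fin1 x unique = mk↔ₛ′ (λ _ → zero) (λ _ → x) (λ { zero → refl }) (λ y → sym (unique y))

↔Fin0 : ∀ {A : Set} → ¬ A → A ↔ Fin 0
↔Fin0 ¬a = mk↔ₛ′ (λ a → contradiction a ¬a) (λ ()) (λ ()) (λ a → contradiction a ¬a)

CU0↔Fin1 : CU 0 ↔ Fin 1
CU0↔Fin1 = ↔Fin1 ([] , ([] , refl) , refl) λ (_ , p) → CU-≡ (Fixed-0⇒[] p)

CU1↔Fin1 : CU 1 ↔ Fin 1
CU1↔Fin1 = ↔Fin1 ([ 1 ] , (s≤s z≤n ∷ [] , refl) , refl) unique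
  where
  unique : ∀ y → y ≡ ([ 1 ] , (s≤s z≤n ∷ [] , refl) , refl)
  unique ([] , (_ , ()) , _)
  unique (a ∷ [] , p) = CU-≡ (cong [_] (Fixed⇒OddOnesEvenEven p))
  unique (a ∷ b ∷ cs , p) = contradiction (Fixed-∷∷⇒3≤ p) λ { (s≤s ()) }

CU2↔Fin0 : CU 2 ↔ Fin 0
CU2↔Fin0 = ↔Fin0 λ where
  ([] , (_ , ()) , _)
  (a ∷ [] , p) → contradiction (Fixed-[a]⇒n≡1 p) λ ()
  (a ∷ b ∷ cs , p) → contradiction (Fixed-∷∷⇒3≤ p) λ { (s≤s (s≤s ())) }

CU3↔Fin1 : CU 3 ↔ Fin 1
CU3↔Fin1 = ↔Fin1 (1 ∷ 2 ∷ [] , (s≤s z≤n ∷ s≤s z≤n ∷ [] , refl) , refl) unique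
  where
  unique : ∀ y → y ≡ (1 ∷ 2 ∷ [] , (s≤s z≤n ∷ s≤s z≤n ∷ [] , refl) , refl)
  unique ([] , (_ , ()) , _)
  unique (a ∷ [] , p) = contradiction (Fixed-[a]⇒n≡1 p) λ ()
  unique (a ∷ 0 ∷ cs , ((_ ∷ () ∷ _ , _) , _))
  unique (a ∷ 1 ∷ cs , p) = contradiction (Fixed⇒2∣second p) 2∤1
  unique (a ∷ 2 ∷ cs , p) =
    CU-≡ (cong₂ (λ h t → h ∷ 2 ∷ t) (Fixed⇒head≡1 p) (Fixed-0⇒[] (Fixed-1∷2∷⁻ p)))
  unique (a ∷ suc (suc (suc b)) ∷ cs , p) = contradiction (Fixed-∷∷⇒3≤ (Fixed-shrink p)) λ { (s≤s ()) }

cU : ℕ → ℕ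
cU 0 = 1
cU 1 = 1
cU 2 = 0
cU 3 = 1
cU (suc (suc (suc (suc m)))) = cU (suc (suc m)) + cU (suc m)

CU↔Fin-cU : ∀ n → CU n ↔ Fin (cU n)
CU↔Fin-cU 0 = CU0↔Fin1
CU↔Fin-cU 1 = CU1↔Fin1
CU↔Fin-cU 2 = CU2↔Fin0
CU↔Fin-cU 3 = CU3↔Fin1
CU↔Fin-cU (suc (suc (suc (suc m)))) =
  ↔-trans (CU-recurrence m) (↔-trans (CU↔Fin-cU (suc (suc m)) ⊎-↔ CU↔Fin-cU (suc m)) (↔-sym +↔⊎))

cU-recurrence : ∀ n → 4 ≤ n → cU n ≡ cU (n ∸ 2) + cU (n ∸ 3)
cU-recurrence _ (s≤s (s≤s (s≤s (s≤s _)))) = refl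

proposition3p3 : ((n : ℕ) (c : List ℕ) → IsComposition n c → (U c ≡ c ⇔ OddOnesEvenEven c))
    × Σ (ℕ → ℕ) (λ cU → ((n : ℕ) → CU n ↔ Fin (cU n))
        × cU 1 ≡ 1 × cU 2 ≡ 0 × cU 3 ≡ 1
        × ((n : ℕ) → 4 ≤ n → cU n ≡ cU (n ∸ 2) + cU (n ∸ 3)))
proposition3p3 =
  (λ _ _ (pos , _) → mk⇔ (U-fixed⇒ pos) (U-fixed⇐ pos)) ,
  cU , CU↔Fin-cU , refl , refl , refl , cU-recurrence
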